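{- Let $M = (Q, \Gamma, \delta, q_0, F)$ be a deterministic verifier Turing machine for an NP problem, with $F = \{q_{\mathrm{acc}}, q_{\mathrm{rej}}\}$. Suppose that on a problem instance $L$ and every certificate of length at most $m$, $M$ halts (answering yes or no) within at most $p(n)$ steps, where $n = |L| + m$ and $p$ is a polynomial. Let $G$ be the computation graph consisting of all computation nodes and edges occurring in the computation walks of $M$ on the inputs formed by $L$ followed by each such certificate. Then $G$ has width $O(p(n))$ and height $O(p(n))$; its number of vertices is $O(p(n)^2)$ and its number of edges is $O(p(n)^3)$.
   Context: A deterministic Turing machine has a finite state set $Q$, final states $F\subseteq Q$, tape alphabet $\Gamma$ (containing a blank $\epsilon$), and partial transition function $\delta : (Q\setminus F)\times\Gamma \to \Gamma\times\{ -1,+1\}\times Q$. Tape cells are indexed by integers (the starting cell has index $0$). A computation node is a 6-tuple $(i, q, \sigma, q^{\perp}, \sigma^{\perp}, t)$: $i$ is the cell index where the head is, $q$ the current state, $\sigma$ the current symbol in cell $i$, $q^{\perp}$ and $\sigma^{\perp}$ the state and the symbol read at the previous transition performed at cell $i$ (undefined if none), and $t$ (the tier) the number of transitions that have previously occurred at cell $i$. The computation walk of a run of $M$ is the sequence of edges $(v_k, v_{k+1})$ between the computation nodes of consecutive steps of the run. The width of a computation graph is the difference between the maximum and minimum cell indices of its vertices; its height is the maximum tier of its vertices. -}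

module Defs where

open import Data.Nat using (ℕ; zero; suc; _+_; _*_; _≤_)
open import Data.Integer as ℤ using (ℤ; +_)
open import Data.Fin using (Fin)
open import Data.Maybe using (Maybe; just; nothing)
open import Data.Product using (_×_; _,_; Σ; ∃; proj₁; proj₂)
open import Data.Sum using (_⊎_)
open import Data.List using (List; []; _∷_; length; _++_)
open import Data.List.Membership.Propositional using (_∈_)
open import Relation.Binary.PropositionalEquality using (_≡_)
open import Relation.Nullary using (¬_; yes; no)

-- Polynomials with natural coefficients, as coefficient lists (constant term first).
evalPoly : List ℕ → ℕ → ℕ
evalPoly []       x = 0
evalPoly (a ∷ as) x = a + x * evalPoly as x

data Dir : Set where
  left right : Dir

dirℤ : Dir → ℤ
dirℤ left  = ℤ.-[1+ 0 ]
dirℤ right = + 1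

record TM : Set where
  field
    nQ nΓ nΣ : ℕ
    blank    : Fin nΓ
    inp      : Fin nΣ → Fin nΓ
    q₀ acc rej : Fin nQ
    acc≢rej  : ¬ (acc ≡ rej)
    δ        : Fin nQ → Fin nΓ → Maybe (Fin nΓ × Dir × Fin nQ)
    δ-acc    : ∀ σ → δ acc σ ≡ nothing
    δ-rej    : ∀ σ → δ rej σ ≡ nothing

module _ (M : TM) where
  open TM M

  Q Γ Σ' : Set
  Q = Fin nQ
  Γ = Fin nΓ
  Σ' = Fin nΣ

  -- Computation node (i , q , σ , (q⊥ , σ⊥) , t); the previous pair is
  -- 'nothing' when no transition has previously occurred at cell i.
  record Node : Set where
    constructor node
    field
      cell  : ℤ
      state : Q
      sym   : Γ
      prev  : Maybe (Q × Γ)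
      tier  : ℕ

  record Config : Set where
    constructor config
    field
      head  : ℤ
      cur   : Q
      tape  : ℤ → Γ
      last  : ℤ → Maybe (Q × Γ)   -- (state, symbol read) at last transition at each cell
      count : ℤ → ℕ               -- number of transitions performed at each cell

  update : {A : Set} → (ℤ → A) → ℤ → A → ℤ → A
  update f i a j with j ℤ.≟ i
  ... | yes _ = a
  ... | no  _ = f j

  nodeOf : Config → Node
  nodeOf (config h q tp ls ct) = node h q (tp h) (ls h) (ct h)

  step : Config → Maybe Config
  step (config h q tp ls ct) with δ q (tp h)
  ... | nothing = nothing
  ... | just (σ' , d , q') =
        just (config (h ℤ.+ dirℤ d) q' (update tp h σ')
                     (update ls h (just (q , tp h))) (update ct h (suc (ct h))))

  run : ℕ → Config → Maybe Config
  run zero    c = just c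
  run (suc k) c with run k c
  ... | nothing = nothing
  ... | just c' = step c'

  inputTape : List Σ' → ℤ → Γ
  inputTape w (ℤ.-[1+ _ ]) = blank
  inputTape [] (+ _) = blank
  inputTape (a ∷ w) (+ zero) = inp a
  inputTape (a ∷ w) (+ suc k) = inputTape w (+ k)

  initConfig : List Σ' → Config
  initConfig w = config (+ 0) q₀ (inputTape w) (λ _ → nothing) (λ _ → 0)

  Final : Q → Set
  Final q = q ≡ acc ⊎ q ≡ rej

  HaltsWithin : List Σ' → ℕ → Set
  HaltsWithin w s = ∃ λ k → k ≤ s × ∃ λ c → run k (initConfig w) ≡ just c × Final (Config.cur c)

  WalkVertex : List Σ' → Node → Set
  WalkVertex w v = ∃ λ k → ∃ λ c → run k (initConfig w) ≡ just c × nodeOf c ≡ v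

  WalkEdge : List Σ' → Node × Node → Set
  WalkEdge w (v , v') = ∃ λ k → ∃ λ c → ∃ λ c' →
    run k (initConfig w) ≡ just c × run (suc k) (initConfig w) ≡ just c' ×
    nodeOf c ≡ v × nodeOf c' ≡ v'

  GVertex : List Σ' → ℕ → Node → Set
  GVertex L m v = ∃ λ (c : List Σ') → length c ≤ m × WalkVertex (L ++ c) v

  GEdge : List Σ' → ℕ → Node × Node → Set
  GEdge L m e = ∃ λ (c : List Σ') → length c ≤ m × WalkEdge (L ++ c) e

AtMost : {A : Set} → (A → Set) → ℕ → Set
AtMost {A} P N = ∃ λ (xs : List A) → length xs ≤ N × (∀ a → P a → a ∈ xs)

-- During a run of t steps the head stays within distance t of cell 0 and no cell is visited more
-- than t times.  Hence, if every run halts within s = p(n) steps, every vertex of G has cell in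
-- [-s, s] and tier at most s, while its state, symbol and previous (state, symbol) range over a
-- set of size K depending only on M: there are at most (2s+1)·K·(s+1) vertices.  An edge is
-- fixed by its source, a direction and the remaining data of its target, so there are at most
-- (2s+1)·K·(s+1) · 2·K·(s+1) edges.
module Submission where

open import Defs
open import Data.Nat using (ℕ; zero; suc; _+_; _*_; _≤_; _<_; z≤n; s≤s; _≤?_)
import Data.Nat.Properties as ℕ
open import Data.Nat.Tactic.RingSolver using (solve-∀)
open import Data.Integer as ℤ using (ℤ; +_; -[1+_]; ∣_∣)
import Data.Integer.Properties as ℤ
open import Data.Fin using (Fin)
open import Data.Maybe using (Maybe; just; nothing)
open import Data.Maybe.Properties using (just-injective)
open import Data.Product using (∃; _×_; _,_; proj₁; proj₂)
open import Data.Sum using (inj₁; inj₂)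
open import Data.Unit using (tt)
open import Data.List using (List; []; _∷_; length; map; _++_; upTo; allFin; cartesianProduct)
open import Data.List.Properties using (length-map; length-++; length-upTo; length-tabulate)
open import Data.List.Membership.Propositional using (_∈_)
open import Data.List.Membership.Propositional.Properties
  using (∈-map⁺; ∈-upTo⁺; ∈-allFin; ∈-cartesianProduct⁺)
open import Data.List.Relation.Unary.Any using (here; there)
open import Function using (_∘_)
open import Relation.Unary using (U; _⟨×⟩_)
open import Relation.Binary.PropositionalEquality
open import Relation.Nullary using (yes; no; contradiction)

length-cartesianProduct : {A B : Set} (xs : List A) (ys : List B) →
  length (cartesianProduct xs ys) ≡ length xs * length ys
length-cartesianProduct []       ys = refl
length-cartesianProduct (x ∷ xs) ys = begin
  length (map (x ,_) ys ++ cartesianProduct xs ys)       ≡⟨ length-++ (map (x ,_) ys) ⟩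
  length (map (x ,_) ys) + length (cartesianProduct xs ys)
    ≡⟨ cong₂ _+_ (length-map (x ,_) ys) (length-cartesianProduct xs ys) ⟩
  length ys + length xs * length ys                        ∎
  where open ≡-Reasoning

module _ {A : Set} where

  AtMost-mono : {P Q : A → Set} {a b : ℕ} →
    (∀ x → P x → Q x) → a ≤ b → AtMost Q a → AtMost P b
  AtMost-mono P⊆Q a≤b (xs , |xs|≤a , cover) =
    xs , ℕ.≤-trans |xs|≤a a≤b , λ x px → cover x (P⊆Q x px)

  AtMost-image : {B : Set} {P : A → Set} {Q : B → Set} {n : ℕ} (f : A → B) →
    (∀ y → Q y → ∃ λ x → P x × f x ≡ y) → AtMost P n → AtMost Q n
  AtMost-image f surj (xs , |xs|≤n , cover) =
    map f xs , ℕ.≤-trans (ℕ.≤-reflexive (length-map f xs)) |xs|≤n , covered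
    where
    covered : ∀ y → _ → y ∈ map f xs
    covered y qy with surj y qy
    ... | x , px , refl = ∈-map⁺ f (cover x px)

  AtMost-× : {B : Set} {P : A → Set} {Q : B → Set} {a b : ℕ} →
    AtMost P a → AtMost Q b → AtMost (P ⟨×⟩ Q) (a * b)
  AtMost-× (xs , |xs|≤a , coverP) (ys , |ys|≤b , coverQ) =
    cartesianProduct xs ys ,
    ℕ.≤-trans (ℕ.≤-reflexive (length-cartesianProduct xs ys)) (ℕ.*-mono-≤ |xs|≤a |ys|≤b) ,
    λ (x , y) (px , qy) → ∈-cartesianProduct⁺ (coverP x px) (coverQ y qy)

  AtMost-Maybe : {n : ℕ} → AtMost {A} U n → AtMost {Maybe A} U (suc n)
  AtMost-Maybe (xs , |xs|≤n , cover) =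
    nothing ∷ map just xs ,
    s≤s (ℕ.≤-trans (ℕ.≤-reflexive (length-map just xs)) |xs|≤n) ,
    λ { nothing _ → here refl ; (just x) _ → there (∈-map⁺ just (cover x tt)) }

AtMost-Fin : (n : ℕ) → AtMost {Fin n} U n
AtMost-Fin n = allFin n , ℕ.≤-reflexive (length-tabulate (λ i → i)) , λ i _ → ∈-allFin i

AtMost-Dir : AtMost {Dir} U 2
AtMost-Dir = left ∷ right ∷ [] , ℕ.≤-refl , λ { left _ → here refl ; right _ → there (here refl) }

AtMost-≤ : (s : ℕ) → AtMost (_≤ s) (suc s)
AtMost-≤ s = upTo (suc s) , ℕ.≤-reflexive (length-upTo (suc s)) , λ t t≤s → ∈-upTo⁺ (s≤s t≤s)

ball : ℕ → List ℤ
ball zero    = + 0 ∷ []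
ball (suc s) = + suc s ∷ -[1+ s ] ∷ ball s

length-ball : ∀ s → length (ball s) ≡ suc (s + s)
length-ball zero    = refl
length-ball (suc s) = cong (suc ∘ suc) (trans (length-ball s) (sym (ℕ.+-suc s s)))

∈-ball : ∀ s {i} → ∣ i ∣ ≤ s → i ∈ ball s
∈-ball zero    {+ zero} _ = here refl
∈-ball (suc s) {+ n} n≤1+s with ℕ.m≤n⇒m<n∨m≡n n≤1+s
... | inj₂ refl      = here refl
... | inj₁ (s≤s n≤s) = there (there (∈-ball s n≤s))
∈-ball (suc s) { -[1+ n ]} (s≤s n≤s) with ℕ.m≤n⇒m<n∨m≡n n≤s
... | inj₂ refl = there (here refl)
... | inj₁ n<s  = there (there (∈-ball s n<s))

AtMost-ball : (s : ℕ) → AtMost (λ i → ∣ i ∣ ≤ s) (suc (s + s))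
AtMost-ball s = ball s , ℕ.≤-reflexive (length-ball s) , λ i → ∈-ball s

i≤+∣i∣ : ∀ i → i ℤ.≤ + ∣ i ∣
i≤+∣i∣ (+ n)    = ℤ.≤-refl
i≤+∣i∣ -[1+ n ] = ℤ.-≤+

i-j≤+[s+s] : ∀ {s} i j → ∣ i ∣ ≤ s → ∣ j ∣ ≤ s → i ℤ.- j ℤ.≤ + (s + s)
i-j≤+[s+s] i j ∣i∣≤s ∣j∣≤s = ℤ.≤-trans (i≤+∣i∣ (i ℤ.- j))
  (ℤ.+≤+ (ℕ.≤-trans (ℤ.∣i-j∣≤∣i∣+∣j∣ i j) (ℕ.+-mono-≤ ∣i∣≤s ∣j∣≤s)))

∣dir∣≤1 : ∀ d → ∣ dirℤ d ∣ ≤ 1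
∣dir∣≤1 left  = ℕ.≤-refl
∣dir∣≤1 right = ℕ.≤-refl

module _ (M : TM) where
  open TM M

  step-head : ∀ c {c'} → step M c ≡ just c' →
    ∃ λ d → Config.head c' ≡ Config.head c ℤ.+ dirℤ d
  step-head (config h q tp ls ct) eq with δ q (tp h)
  step-head (config h q tp ls ct) refl | just (_ , d , _) = d , refl

  step-count : ∀ c {c'} {k} → step M c ≡ just c' →
    (∀ i → Config.count c i ≤ k) → ∀ i → Config.count c' i ≤ suc k
  step-count (config h q tp ls ct) eq ct≤k i with δ q (tp h)
  step-count (config h q tp ls ct) refl ct≤k i | just _ with i ℤ.≟ h
  ... | yes _ = s≤s (ct≤k h)
  ... | no  _ = ℕ.m≤n⇒m≤1+n (ct≤k i)

  final-step : ∀ c → Final M (Config.cur c) → step M c ≡ nothing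
  final-step (config h q tp ls ct) (inj₁ refl) rewrite δ-acc (tp h) = refl
  final-step (config h q tp ls ct) (inj₂ refl) rewrite δ-rej (tp h) = refl

  run-suc⁻ : ∀ k c {c'} → run M (suc k) c ≡ just c' →
    ∃ λ c'' → run M k c ≡ just c'' × step M c'' ≡ just c'
  run-suc⁻ k c eq with run M k c
  ... | just c'' = c'' , refl , eq

  run-bounded : ∀ w k {c} → run M k (initConfig M w) ≡ just c →
    ∣ Config.head c ∣ ≤ k × (∀ i → Config.count c i ≤ k)
  run-bounded w zero    refl = z≤n , λ _ → z≤n
  run-bounded w (suc k) eq with run-suc⁻ k _ eq
  ... | c'' , run-k , stepped with run-bounded w k run-k | step-head c'' stepped
  ... | ∣head∣≤k , count≤k | d , refl =
    ℕ.≤-trans (ℤ.∣i+j∣≤∣i∣+∣j∣ (Config.head c'') (dirℤ d))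
              (ℕ.≤-trans (ℕ.+-mono-≤ ∣head∣≤k (∣dir∣≤1 d)) (ℕ.≤-reflexive (ℕ.+-comm k 1))) ,
    step-count c'' stepped count≤k

  run-after-stop : ∀ c₀ k {c} → run M k c₀ ≡ just c → step M c ≡ nothing →
    ∀ j → k < j → run M j c₀ ≡ nothing
  run-after-stop c₀ k run-k stuck (suc j) (s≤s k≤j) with ℕ.m≤n⇒m<n∨m≡n k≤j
  ... | inj₂ refl rewrite run-k = stuck
  ... | inj₁ k<j  rewrite run-after-stop c₀ k run-k stuck j k<j = refl

  run-length≤ : ∀ w s → HaltsWithin M w s → ∀ j {c} → run M j (initConfig M w) ≡ just c → j ≤ s
  run-length≤ w s (k , k≤s , c , run-k , final) j run-j with j ≤? k
  ... | yes j≤k = ℕ.≤-trans j≤k k≤s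
  ... | no  j≰k = contradiction
    (trans (sym run-j) (run-after-stop (initConfig M w) k run-k (final-step c final) j (ℕ.≰⇒> j≰k)))
    λ ()

  NodeWithin : ℕ → Node M → Set
  NodeWithin s v = ∣ Node.cell v ∣ ≤ s × Node.tier v ≤ s

  EdgeWithin : ℕ → Node M × Node M → Set
  EdgeWithin s (v , v') =
    NodeWithin s v × Node.tier v' ≤ s × ∃ λ d → Node.cell v' ≡ Node.cell v ℤ.+ dirℤ d

  walkVertex-within : ∀ w s → HaltsWithin M w s → ∀ v → WalkVertex M w v → NodeWithin s v
  walkVertex-within w s halts v (k , c , run-k , refl) =
    ℕ.≤-trans (proj₁ (run-bounded w k run-k)) k≤s ,
    ℕ.≤-trans (proj₂ (run-bounded w k run-k) (Config.head c)) k≤s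
    where k≤s = run-length≤ w s halts k run-k

  walkEdge-within : ∀ w s → HaltsWithin M w s → ∀ e → WalkEdge M w e → EdgeWithin s e
  walkEdge-within w s halts (v , v') (k , c , c' , run-k , run-1+k , refl , refl)
    with run-suc⁻ k _ run-1+k
  ... | c'' , run-k' , stepped with just-injective (trans (sym run-k) run-k')
  ... | refl =
    walkVertex-within w s halts v (k , c , run-k , refl) ,
    proj₂ (walkVertex-within w s halts v' (suc k , c' , run-1+k , refl)) ,
    step-head c stepped

  module _ {L : List (Σ' M)} {m s : ℕ}
           (halts : ∀ c → length c ≤ m → HaltsWithin M (L ++ c) s) where

    graphVertex-within : ∀ v → GVertex M L m v → NodeWithin s v
    graphVertex-within v (c , |c|≤m , walk) = walkVertex-within (L ++ c) s (halts c |c|≤m) v walk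

    graphEdge-within : ∀ e → GEdge M L m e → EdgeWithin s e
    graphEdge-within e (c , |c|≤m , walk) = walkEdge-within (L ++ c) s (halts c |c|≤m) e walk

  Label : Set
  Label = Fin nQ × Fin nΓ × Maybe (Fin nQ × Fin nΓ) × ℕ

  at : ℤ → Label → Node M
  at i (q , σ , h , t) = node i q σ h t

  labelCount : ℕ
  labelCount = nQ * (nΓ * suc (nQ * nΓ))

  AtMost-Label : ∀ s → AtMost {Label} (U ⟨×⟩ U ⟨×⟩ U ⟨×⟩ (_≤ s)) (labelCount * suc s)
  AtMost-Label s = AtMost-mono (λ _ ℓ → ℓ) (ℕ.≤-reflexive reassoc)
    (AtMost-× (AtMost-Fin nQ) (AtMost-× (AtMost-Fin nΓ) (AtMost-× traces (AtMost-≤ s))))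
    where
    traces = AtMost-Maybe (AtMost-mono (λ _ _ → tt , tt) ℕ.≤-refl
                                       (AtMost-× (AtMost-Fin nQ) (AtMost-Fin nΓ)))
    reassoc : nQ * (nΓ * (suc (nQ * nΓ) * suc s)) ≡ labelCount * suc s
    reassoc = trans (cong (nQ *_) (sym (ℕ.*-assoc nΓ _ (suc s)))) (sym (ℕ.*-assoc nQ _ (suc s)))

  AtMost-NodeWithin : ∀ s → AtMost (NodeWithin s) (suc (s + s) * (labelCount * suc s))
  AtMost-NodeWithin s = AtMost-image (λ (i , ℓ) → at i ℓ)
    (λ { (node i q σ h t) (∣i∣≤s , t≤s) → (i , q , σ , h , t) , (∣i∣≤s , tt , tt , tt , t≤s) , refl })
    (AtMost-× (AtMost-ball s) (AtMost-Label s))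

  AtMost-EdgeWithin : ∀ s →
    AtMost (EdgeWithin s) ((suc (s + s) * (labelCount * suc s)) * (2 * (labelCount * suc s)))
  AtMost-EdgeWithin s = AtMost-image (λ ((i , ℓ) , d , ℓ') → at i ℓ , at (i ℤ.+ dirℤ d) ℓ')
    (λ { (node i q σ h t , node _ q' σ' h' t') ((∣i∣≤s , t≤s) , t'≤s , d , refl) →
           ((i , q , σ , h , t) , d , (q' , σ' , h' , t')) ,
           ((∣i∣≤s , tt , tt , tt , t≤s) , tt , (tt , tt , tt , t'≤s)) , refl })
    (AtMost-× (AtMost-× (AtMost-ball s) (AtMost-Label s)) (AtMost-× AtMost-Dir (AtMost-Label s)))

sizeConstant : ℕ → ℕ
sizeConstant K = 2 + 2 * K + 4 * (K * K)

module _ (K s : ℕ) where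
  open ℕ.≤-Reasoning

  private
    C = sizeConstant K
    P = suc s

    2≤C : 2 ≤ C
    2≤C = ℕ.≤-trans (ℕ.m≤m+n 2 (2 * K)) (ℕ.m≤m+n _ _)

    2K≤C : 2 * K ≤ C
    2K≤C = ℕ.≤-trans (ℕ.m≤n+m (2 * K) 2) (ℕ.m≤m+n _ _)

    4K²≤C : 4 * (K * K) ≤ C
    4K²≤C = ℕ.m≤n+m (4 * (K * K)) (2 + 2 * K)

    [2x][yx]≡[2y][xx] : ∀ x y → (2 * x) * (y * x) ≡ (2 * y) * (x * x)
    [2x][yx]≡[2y][xx] = solve-∀

    [2x][yx][2[yx]]≡[4[yy]][x[xx]] : ∀ x y →
      ((2 * x) * (y * x)) * (2 * (y * x)) ≡ (4 * (y * y)) * (x * (x * x))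
    [2x][yx][2[yx]]≡[4[yy]][x[xx]] = solve-∀

    1+2s≤2P : suc (s + s) ≤ 2 * P
    1+2s≤2P = ℕ.≤-trans (ℕ.n≤1+n _) (ℕ.≤-reflexive (2+2s≡2[1+s] s))
      where 2+2s≡2[1+s] : ∀ s → suc (suc (s + s)) ≡ 2 * suc s
            2+2s≡2[1+s] = solve-∀

  s≤sizeConstant*P : s ≤ C * P
  s≤sizeConstant*P = begin
    s       ≤⟨ ℕ.n≤1+n s ⟩
    P       ≡⟨ ℕ.*-identityˡ P ⟨
    1 * P   ≤⟨ ℕ.*-monoˡ-≤ P (ℕ.≤-trans (s≤s z≤n) 2≤C) ⟩
    C * P   ∎

  s+s≤sizeConstant*P : s + s ≤ C * P
  s+s≤sizeConstant*P = begin
    s + s        ≤⟨ ℕ.n≤1+n _ ⟩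
    suc (s + s)  ≤⟨ 1+2s≤2P ⟩
    2 * P        ≤⟨ ℕ.*-monoˡ-≤ P 2≤C ⟩
    C * P        ∎

  vertexCount≤ : suc (s + s) * (K * P) ≤ C * (P * P)
  vertexCount≤ = begin
    suc (s + s) * (K * P) ≤⟨ ℕ.*-monoˡ-≤ (K * P) 1+2s≤2P ⟩
    (2 * P) * (K * P)     ≡⟨ [2x][yx]≡[2y][xx] P K ⟩
    (2 * K) * (P * P)     ≤⟨ ℕ.*-monoˡ-≤ (P * P) 2K≤C ⟩
    C * (P * P)           ∎

  edgeCount≤ : (suc (s + s) * (K * P)) * (2 * (K * P)) ≤ C * (P * (P * P))
  edgeCount≤ = begin
    (suc (s + s) * (K * P)) * (2 * (K * P)) ≤⟨ ℕ.*-monoˡ-≤ (2 * (K * P)) (ℕ.*-monoˡ-≤ (K * P) 1+2s≤2P) ⟩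
    ((2 * P) * (K * P)) * (2 * (K * P))     ≡⟨ [2x][yx][2[yx]]≡[4[yy]][x[xx]] P K ⟩
    (4 * (K * K)) * (P * (P * P))           ≤⟨ ℕ.*-monoˡ-≤ (P * (P * P)) 4K²≤C ⟩
    C * (P * (P * P))                       ∎

mainTheorem2 : (M : TM) (p : List ℕ) →
    ∃ λ (C : ℕ) → ∀ (L : List (Σ' M)) (m : ℕ) →
    let n = length L + m
        P = suc (evalPoly p n)
    in (∀ (c : List (Σ' M)) → length c ≤ m → HaltsWithin M (L ++ c) (evalPoly p n)) →
       (∀ v w → GVertex M L m v → GVertex M L m w →
          Node.cell v ℤ.- Node.cell w ℤ.≤ + (C * P))
     × (∀ v → GVertex M L m v → Node.tier v ≤ C * P)
     × AtMost (GVertex M L m) (C * (P * P))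
     × AtMost (GEdge M L m) (C * (P * (P * P)))
mainTheorem2 M p = sizeConstant K , λ L m halts →
  let s = evalPoly p (length L + m)
      inBox = graphVertex-within M halts
  in (λ v w v∈G w∈G → ℤ.≤-trans
        (i-j≤+[s+s] (Node.cell v) (Node.cell w) (proj₁ (inBox v v∈G)) (proj₁ (inBox w w∈G)))
        (ℤ.+≤+ (s+s≤sizeConstant*P K s)))
   , (λ v v∈G → ℕ.≤-trans (proj₂ (inBox v v∈G)) (s≤sizeConstant*P K s))
   , AtMost-mono inBox (vertexCount≤ K s) (AtMost-NodeWithin M s)
   , AtMost-mono (graphEdge-within M halts) (edgeCount≤ K s) (AtMost-EdgeWithin M s)
  where K = labelCount M
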